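{- Let $a,n\in\mathbb{N}$, let $k_1,\ldots,k_n\in\mathbb{N}$ and put $K=\operatorname{lcm}(k_1,\ldots,k_n)$. Let $f_1,\ldots,f_n$, $g_1,\ldots,g_n$, $h_1,\ldots,h_n$ be arbitrary arithmetic functions and let $\omega$ be a completely multiplicative arithmetic function. Put $$U_{\omega}^{(a)}(k_1,\ldots,k_n)=\sum_{j=1}^{K^a}\omega(j)\,s^{(a)}_{f_1,g_1,h_1}(k_1,j)\cdots s^{(a)}_{f_n,g_n,h_n}(k_n,j).$$ For divisors $d_1|k_1,\ldots,d_n|k_n$ write $M=\operatorname{lcm}(d_1,\ldots,d_n)$ and $L=K/M$. Then $$U_{\omega}^{(a)}(k_1,\ldots,k_n)=\sum_{d_1|k_1,\ldots,d_n|k_n}(\omega(M))^a\Bigl(\prod_{i=1}^n f_i(d_i)g_i\Bigl(\frac{k_i}{d_i}\Bigr)\Bigr)\sum_{\ell=1}^{L^a}\omega(\ell)\prod_{i=1}^n h_i\Bigl(\Bigl(\frac{M}{d_i}\Bigr)^a\ell\Bigr).$$ If in addition $h_1,\ldots,h_n$ are completely multiplicative, then $$U_{\omega}^{(a)}(k_1,\ldots,k_n)=\sum_{d_1|k_1,\ldots,d_n|k_n}(\omega(M))^a\Bigl(\prod_{i=1}^n f_i(d_i)g_i\Bigl(\frac{k_i}{d_i}\Bigr)\Bigl(h_i\Bigl(\frac{M}{d_i}\Bigr)\Bigr)^a\Bigr)\sum_{\ell=1}^{L^a}\omega(\ell)\prod_{i=1}^n h_i(\ell).$$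
   Context: For $a\in\mathbb{N}$ and arithmetic functions $f,g,h$, the generalized Anderson–Apostol sum is $s^{(a)}_{f,g,h}(k,j)=\sum_{d|k,\ d^a|j} f(d)\,g(k/d)\,h(j/d^a)$ for $k,j\in\mathbb{N}$. Arithmetic functions are complex-valued functions on $\mathbb{N}$. -}

module Defs where

open import Level using (Level)
open import Data.Nat using (ℕ; zero; suc; _/_) renaming (_*_ to _*ℕ_; _^_ to _^ℕ_)
open import Data.Nat.Divisibility using (_∣_; _∣?_)
open import Data.Nat.LCM using (lcm)
open import Data.Fin using (Fin)
import Data.Fin as Fin
open import Data.List using (List; []; _∷_; map; filter; upTo; concatMap)
open import Data.Vec.Functional using () renaming (_∷_ to _∷ᶠ_)
open import Algebra.Bundles using (CommutativeRing)

-- Natural-number quotient m / d, with the (never used) convention m / 0 = 0.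
quot : ℕ → ℕ → ℕ
quot m zero    = zero
quot m (suc d) = m / suc d

lcmF : ∀ {n} → (Fin n → ℕ) → ℕ
lcmF {zero}  k = 1
lcmF {suc n} k = lcm (k Fin.zero) (lcmF (λ i → k (Fin.suc i)))

range1 : ℕ → List ℕ
range1 N = map suc (upTo N)

divisors : ℕ → List ℕ
divisors k = filter (λ d → d ∣? k) (range1 k)

divTuples : ∀ {n} → (Fin n → ℕ) → List (Fin n → ℕ)
divTuples {zero}  k = (λ ()) ∷ []
divTuples {suc n} k =
  concatMap (λ d → map (λ t → d ∷ᶠ t) (divTuples (λ i → k (Fin.suc i))))
            (divisors (k Fin.zero))

module RingDefs {c ℓ : Level} (R : CommutativeRing c ℓ) where
  open CommutativeRing R

  -- arithmetic functions with values in R (value at 0 is irrelevant)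
  ArithFun : Set c
  ArithFun = ℕ → Carrier

  CompletelyMultiplicative : ArithFun → Set ℓ
  CompletelyMultiplicative f =
    (f 1 ≈ 1#) × (∀ m n → f (suc m *ℕ suc n) ≈ f (suc m) * f (suc n))
    where open import Data.Product using (_×_)

  pow : Carrier → ℕ → Carrier
  pow x zero    = 1#
  pow x (suc e) = x * pow x e

  sumL : List Carrier → Carrier
  sumL []       = 0#
  sumL (x ∷ xs) = x + sumL xs

  sumTo : ℕ → (ℕ → Carrier) → Carrier
  sumTo N F = sumL (map F (range1 N))

  prodF : ∀ {n} → (Fin n → Carrier) → Carrier
  prodF {zero}  F = 1#
  prodF {suc n} F = F Fin.zero * prodF (λ i → F (Fin.suc i))

  sAA : ℕ → ArithFun → ArithFun → ArithFun → ℕ → ℕ → Carrier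
  sAA a f g h k j =
    sumL (map (λ d → f d * g (quot k d) * h (quot j (d ^ℕ a)))
              (filter (λ d → (d ^ℕ a) ∣? j) (divisors k)))

  U : (a : ℕ) {n : ℕ} (ω : ArithFun) (f g h : Fin n → ArithFun) (k : Fin n → ℕ) → Carrier
  U a ω f g h k =
    sumTo (lcmF k ^ℕ a) (λ j → ω j * prodF (λ i → sAA a (f i) (g i) (h i) (k i) j))

  sumDiv : ∀ {n} → (Fin n → ℕ) → ((Fin n → ℕ) → Carrier) → Carrier
  sumDiv k F = sumL (map F (divTuples k))

{-# OPTIONS --safe #-}
module Submission where

-- Write sᵢ(kᵢ, j) as a sum over all dᵢ ∣ kᵢ of indicator(dᵢᵃ ∣ j) times its summand and
-- interchange the summations: U becomes a sum over divisor tuples d of sums over j ≤ Kᵃ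
-- restricted to d₁ᵃ, …, dₙᵃ ∣ j, i.e. to Mᵃ ∣ j for M = lcm(d₁, …, dₙ). The surviving j are
-- Mᵃ l with l ≤ Lᵃ (as K = L M), and for them ω(j) = ω(M)ᵃ ω(l) and j / dᵢᵃ = (M / dᵢ)ᵃ l.
-- When the hᵢ are completely multiplicative, hᵢ((M / dᵢ)ᵃ l) = hᵢ(M / dᵢ)ᵃ hᵢ(l) and these
-- factors leave the inner sum. None of the positivity hypotheses is needed.

open import Defs
open import Level using (Level)
open import Data.Nat using (ℕ; NonZero) renaming (_*_ to _*ℕ_; _^_ to _^ℕ_)
open import Data.Fin using (Fin)
open import Data.Product using (_×_; _,_)
open import Algebra.Bundles using (CommutativeRing)

module Arithmetic where

  open import Data.Nat
  open import Data.Nat.Properties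
  open import Data.Nat.Divisibility
  open import Data.Nat.GCD
  open import Data.Nat.LCM
  open import Data.Nat.Coprimality as Coprime using (Coprime; coprime-divisor; coprime-/gcd)
  open import Data.Nat.DivMod using (m/n*n≡m; m*n/n≡m)
  open import Data.Nat.Tactic.RingSolver using (solve-∀)
  open import Data.Fin using (zero; suc)
  open import Data.Sum using (inj₁)
  open import Data.List using (map; upTo)
  open import Data.List.Relation.Unary.All as All using (All; []; _∷_)
  open import Data.List.Relation.Unary.All.Properties using (map⁺; concat⁺; filter⁺; all-filter)
  open import Data.Vec.Functional using () renaming (_∷_ to _∷ᶠ_)
  open import Relation.Binary.PropositionalEquality
  open import Algebra.Properties.CommutativeSemigroup *-commutativeSemigroup using (xy∙z≈xz∙y)

  ^-distrib-* : ∀ m n a → (m * n) ^ a ≡ m ^ a * n ^ a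
  ^-distrib-* m n zero    = refl
  ^-distrib-* m n (suc a) =
    trans (cong (m * n *_) (^-distrib-* m n a)) ([m*n]*[o*p]≡[m*o]*[n*p] m n (m ^ a) (n ^ a))

  ^-monoˡ-∣ : ∀ {m n} a → m ∣ n → m ^ a ∣ n ^ a
  ^-monoˡ-∣ zero    _   = ∣-refl
  ^-monoˡ-∣ (suc a) m∣n = *-pres-∣ m∣n (^-monoˡ-∣ a m∣n)

  coprime-* : ∀ {m n o} → Coprime m n → Coprime m o → Coprime m (n * o)
  coprime-* {n = n} m⊥n m⊥o {d} (d∣m , d∣no) = m⊥o (d∣m , coprime-divisor d⊥n d∣no)
    where
    d⊥n : Coprime d n
    d⊥n (e∣d , e∣n) = m⊥n (∣-trans e∣d d∣m , e∣n)

  coprime-^ʳ : ∀ {m n} a → Coprime m n → Coprime m (n ^ a)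
  coprime-^ʳ zero    m⊥n (_ , d∣1) = ∣1⇒≡1 d∣1
  coprime-^ʳ (suc a) m⊥n = coprime-* m⊥n (coprime-^ʳ a m⊥n)

  coprime-^ : ∀ {m n} a b → Coprime m n → Coprime (m ^ a) (n ^ b)
  coprime-^ a b m⊥n = Coprime.sym (coprime-^ʳ a (Coprime.sym (coprime-^ʳ b m⊥n)))

  coprime-∣⇒*∣ : ∀ {m n o} → Coprime m n → m ∣ o → n ∣ o → m * n ∣ o
  coprime-∣⇒*∣ {m} {n} m⊥n (divides q refl) n∣qm =
    ∣-trans (*-monoʳ-∣ m n∣q) (∣-reflexive (*-comm m q))
    where n∣q = coprime-divisor (Coprime.sym m⊥n) (subst (n ∣_) (*-comm q m) n∣qm)

  -- With g = gcd m n, m = m′g and n = n′g with m′, n′ coprime, and lcm m n = m′n′g.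
  lcm-^-least : ∀ {m n o} a → m ^ a ∣ o → n ^ a ∣ o → lcm m n ^ a ∣ o
  lcm-^-least {zero} {n} {o} a 0^a∣o _ = subst (λ l → l ^ a ∣ o) (sym (lcm[0,n]≡0 n)) 0^a∣o
  lcm-^-least {m@(suc _)} {n} {o} a m^a∣o n^a∣o =
    subst₂ _∣_ (sym lcm^a≡) (sym o≡) (*-monoˡ-∣ (g ^ a) m′^a*n′^a∣o′)
    where
    g = gcd m n
    instance
      g≢0 : NonZero g
      g≢0 = ≢-nonZero (gcd[m,n]≢0 m n (inj₁ λ ()))
      g^a≢0 : NonZero (g ^ a)
      g^a≢0 = m^n≢0 g a
    m′ = m / g
    n′ = n / g
    m≡ : m ≡ m′ * g
    m≡ = sym (m/n*n≡m (gcd[m,n]∣m m n))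
    n≡ : n ≡ n′ * g
    n≡ = sym (m/n*n≡m (gcd[m,n]∣n m n))
    lcm≡ : lcm m n ≡ m′ * n′ * g
    lcm≡ = *-cancelˡ-≡ (lcm m n) (m′ * n′ * g) g (begin
      g * lcm m n         ≡⟨ gcd*lcm m n ⟩
      m * n               ≡⟨ cong₂ _*_ m≡ n≡ ⟩
      (m′ * g) * (n′ * g) ≡⟨ regroup m′ n′ g ⟩
      g * (m′ * n′ * g)   ∎)
      where
      open ≡-Reasoning
      regroup : ∀ x y z → (x * z) * (y * z) ≡ z * (x * y * z)
      regroup = solve-∀
    g^a∣o : g ^ a ∣ o
    g^a∣o = ∣-trans (^-monoˡ-∣ a (gcd[m,n]∣m m n)) m^a∣o
    o′ = quotient g^a∣o
    o≡ : o ≡ o′ * g ^ a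
    o≡ = m∣n⇒n≡quotient*m g^a∣o
    cancel-g^a : ∀ {x} → x ≡ x / g * g → x ^ a ∣ o → (x / g) ^ a ∣ o′
    cancel-g^a x≡ x^a∣o =
      *-cancelʳ-∣ (g ^ a) (subst₂ _∣_ (trans (cong (_^ a) x≡) (^-distrib-* _ g a)) o≡ x^a∣o)
    m′^a*n′^a∣o′ : m′ ^ a * n′ ^ a ∣ o′
    m′^a*n′^a∣o′ =
      coprime-∣⇒*∣ (coprime-^ a a (coprime-/gcd m n)) (cancel-g^a m≡ m^a∣o) (cancel-g^a n≡ n^a∣o)
    lcm^a≡ : lcm m n ^ a ≡ m′ ^ a * n′ ^ a * g ^ a
    lcm^a≡ = trans (cong (_^ a) lcm≡)
                   (trans (^-distrib-* (m′ * n′) g a) (cong (_* g ^ a) (^-distrib-* m′ n′ a)))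

  lcm-nonZero : ∀ m n → .{{NonZero m}} → .{{NonZero n}} → NonZero (lcm m n)
  lcm-nonZero m n = ≢-nonZero λ lcm≡0 → ≢-nonZero⁻¹ (m * n) {{m*n≢0 m n}}
    (trans (sym (gcd*lcm m n)) (trans (cong (gcd m n *_) lcm≡0) (*-zeroʳ (gcd m n))))

  lcmF-nonZero : ∀ {n} (d : Fin n → ℕ) → (∀ i → NonZero (d i)) → NonZero (lcmF d)
  lcmF-nonZero {zero}  d d≢0 = _
  lcmF-nonZero {suc n} d d≢0 = lcm-nonZero (d zero) (lcmF (λ i → d (suc i)))
    {{d≢0 zero}} {{lcmF-nonZero (λ i → d (suc i)) (λ i → d≢0 (suc i))}}

  lcmF-∣ : ∀ {n} (d : Fin n → ℕ) i → d i ∣ lcmF d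
  lcmF-∣ d zero    = m∣lcm[m,n] _ _
  lcmF-∣ d (suc i) = ∣-trans (lcmF-∣ (λ i → d (suc i)) i) (n∣lcm[m,n] (d zero) _)

  lcmF-least : ∀ {n} (d : Fin n → ℕ) {o} → (∀ i → d i ∣ o) → lcmF d ∣ o
  lcmF-least {zero}  d {o} d∣o = 1∣ o
  lcmF-least {suc n} d d∣o = lcm-least (d∣o zero) (lcmF-least (λ i → d (suc i)) (λ i → d∣o (suc i)))

  lcmF-^-least : ∀ {n} (d : Fin n → ℕ) a {o} → (∀ i → d i ^ a ∣ o) → lcmF d ^ a ∣ o
  lcmF-^-least {zero}  d a {o} _ = subst (_∣ o) (sym (^-zeroˡ a)) (1∣ o)
  lcmF-^-least {suc n} d a d^a∣o =
    lcm-^-least a (d^a∣o zero) (lcmF-^-least (λ i → d (suc i)) a (λ i → d^a∣o (suc i)))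

  quot[m*n,n]≡m : ∀ m n → .{{NonZero n}} → quot (m * n) n ≡ m
  quot[m*n,n]≡m m (suc n) = m*n/n≡m m (suc n)

  quot[m,n]*n≡m : ∀ {m} n → .{{NonZero n}} → n ∣ m → quot m n * n ≡ m
  quot[m,n]*n≡m (suc n) n∣m = m/n*n≡m n∣m

  quot-nonZero : ∀ {m} n → .{{NonZero m}} → .{{NonZero n}} → n ∣ m → NonZero (quot m n)
  quot-nonZero {m} n n∣m = ≢-nonZero λ q≡0 →
    ≢-nonZero⁻¹ m (trans (sym (quot[m,n]*n≡m n n∣m)) (cong (_* n) q≡0))

  quot-^-* : ∀ {m} n a l → .{{NonZero n}} → n ∣ m → quot (m ^ a * l) (n ^ a) ≡ quot m n ^ a * l
  quot-^-* {m} n a l n∣m =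
    trans (cong (λ x → quot x (n ^ a)) m^a*l≡) (quot[m*n,n]≡m _ (n ^ a) {{m^n≢0 n a}})
    where
    q = quot m n
    m^a*l≡ : m ^ a * l ≡ q ^ a * l * n ^ a
    m^a*l≡ = begin
      m ^ a * l           ≡⟨ cong (λ x → x ^ a * l) (sym (quot[m,n]*n≡m n n∣m)) ⟩
      (q * n) ^ a * l     ≡⟨ cong (_* l) (^-distrib-* q n a) ⟩
      q ^ a * n ^ a * l   ≡⟨ xy∙z≈xz∙y (q ^ a) (n ^ a) l ⟩
      q ^ a * l * n ^ a   ∎
      where open ≡-Reasoning

  IsDivisorTuple : ∀ {n} → (k d : Fin n → ℕ) → Set
  IsDivisorTuple k d = ∀ i → NonZero (d i) × d i ∣ k i

  divisors-valid : ∀ m → All (λ e → NonZero e × e ∣ m) (divisors m)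
  divisors-valid m =
    All.zip (filter⁺ (_∣? m) (map⁺ (All.universal (λ _ → _) (upTo m))) , all-filter (_∣? m) (range1 m))

  divTuples-valid : ∀ {n} (k : Fin n → ℕ) → All (IsDivisorTuple k) (divTuples k)
  divTuples-valid {zero}  k = (λ ()) ∷ []
  divTuples-valid {suc n} k = concat⁺ (map⁺ (All.map extend (divisors-valid (k zero))))
    where
    extend : ∀ {e} → NonZero e × e ∣ k zero →
             All (IsDivisorTuple k) (map (e ∷ᶠ_) (divTuples (λ i → k (suc i))))
    extend e-valid = map⁺ (All.map (λ t-valid → λ { zero → e-valid ; (suc i) → t-valid i })
                                   (divTuples-valid (λ i → k (suc i))))

open Arithmetic

module Sums {c ℓ : Level} (R : CommutativeRing c ℓ) where

  open CommutativeRing R hiding (zero)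
  open RingDefs R
  open import Data.Nat using (zero; suc; _≤_; z≤n; s≤s) renaming (_+_ to _+ℕ_; _*_ to _*ℕ_)
  import Data.Nat.Properties as ℕₚ
  open import Data.Nat.Divisibility using (_∣_; _∣?_; ∣-refl; ∣⇒≤; ∣m+n∣m⇒∣n; ∣m∣n⇒∣m+n)
  open import Data.Fin using (zero; suc)
  open import Data.Fin.Properties using (all?)
  open import Data.Bool using (if_then_else_)
  open import Data.List using (List; []; _∷_; map; filter; concatMap; _++_)
  open import Data.List.Properties using (map-upTo)
  open import Data.List.Relation.Unary.All using (All; []; _∷_)
  open import Data.Vec.Functional using () renaming (_∷_ to _∷ᶠ_)
  open import Relation.Nullary using (Dec; yes; no; does; ¬_; contradiction)
  open import Relation.Unary using (Pred; Decidable)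
  open import Relation.Binary.PropositionalEquality as ≡ using (_≡_)
  open import Relation.Binary.Reasoning.Setoid setoid
  open import Algebra.Properties.CommutativeSemigroup +-commutativeSemigroup
    using () renaming (interchange to +-interchange)
  open import Algebra.Properties.CommutativeSemigroup *-commutativeSemigroup
    using () renaming (interchange to *-interchange)

  indicator : ∀ {p} {P : Set p} → Dec P → Carrier → Carrier
  indicator P? x = if does P? then x else 0#

  module _ {p} {P : Set p} where

    indicator-yes : (P? : Dec P) → P → ∀ x → indicator P? x ≈ x
    indicator-yes (yes _)  _ x = refl
    indicator-yes (no ¬p) p x = contradiction p ¬p

    indicator-no : (P? : Dec P) → ¬ P → ∀ x → indicator P? x ≈ 0#
    indicator-no (yes p) ¬p x = contradiction p ¬p
    indicator-no (no _)  _  x = refl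

    *-indicator : (P? : Dec P) → ∀ x y → x * indicator P? y ≈ indicator P? (x * y)
    *-indicator (yes _) x y = refl
    *-indicator (no _)  x y = zeroʳ x

    indicator-cong : ∀ {q} {Q : Set q} (P? : Dec P) (Q? : Dec Q) → (P → Q) → (Q → P) →
                     ∀ {x y} → x ≈ y → indicator P? x ≈ indicator Q? y
    indicator-cong (yes _) (yes _) _   _   x≈y = x≈y
    indicator-cong (no _)  (no _)  _   _   _   = refl
    indicator-cong (yes p) (no ¬q) P⇒Q _   _   = contradiction (P⇒Q p) ¬q
    indicator-cong (no ¬p) (yes q) _   Q⇒P _   = contradiction (Q⇒P q) ¬p

  sumOver : ∀ {a} {A : Set a} → List A → (A → Carrier) → Carrier
  sumOver xs F = sumL (map F xs)

  module _ {a} {A : Set a} where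

    sumOver-cong : ∀ xs {F G : A → Carrier} → (∀ x → F x ≈ G x) → sumOver xs F ≈ sumOver xs G
    sumOver-cong []       F≈G = refl
    sumOver-cong (x ∷ xs) F≈G = +-cong (F≈G x) (sumOver-cong xs F≈G)

    sumOver-congᴬ : ∀ {p} {P : Pred A p} {xs} → All P xs → {F G : A → Carrier} →
                    (∀ x → P x → F x ≈ G x) → sumOver xs F ≈ sumOver xs G
    sumOver-congᴬ []         F≈G = refl
    sumOver-congᴬ (px ∷ pxs) F≈G = +-cong (F≈G _ px) (sumOver-congᴬ pxs F≈G)

    sumOver-zero : ∀ xs → sumOver {A = A} xs (λ _ → 0#) ≈ 0#
    sumOver-zero []       = refl
    sumOver-zero (x ∷ xs) = trans (+-congˡ (sumOver-zero xs)) (+-identityˡ 0#)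

    sumOver-+ : ∀ xs (F G : A → Carrier) → sumOver xs (λ x → F x + G x) ≈ sumOver xs F + sumOver xs G
    sumOver-+ []       F G = sym (+-identityˡ 0#)
    sumOver-+ (x ∷ xs) F G = trans (+-congˡ (sumOver-+ xs F G)) (+-interchange (F x) (G x) _ _)

    *-distribˡ-sumOver : ∀ xs y (F : A → Carrier) → y * sumOver xs F ≈ sumOver xs (λ x → y * F x)
    *-distribˡ-sumOver []       y F = zeroʳ y
    *-distribˡ-sumOver (x ∷ xs) y F = trans (distribˡ y _ _) (+-congˡ (*-distribˡ-sumOver xs y F))

    *-distribʳ-sumOver : ∀ xs y (F : A → Carrier) → sumOver xs F * y ≈ sumOver xs (λ x → F x * y)
    *-distribʳ-sumOver []       y F = zeroˡ y
    *-distribʳ-sumOver (x ∷ xs) y F = trans (distribʳ y _ _) (+-congˡ (*-distribʳ-sumOver xs y F))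

    sumOver-++ : ∀ xs ys (F : A → Carrier) → sumOver (xs ++ ys) F ≈ sumOver xs F + sumOver ys F
    sumOver-++ []       ys F = sym (+-identityˡ _)
    sumOver-++ (x ∷ xs) ys F = trans (+-congˡ (sumOver-++ xs ys F)) (sym (+-assoc _ _ _))

    sumOver-filter : ∀ {p} {P : Pred A p} (P? : Decidable P) xs (F : A → Carrier) →
                     sumOver (filter P? xs) F ≈ sumOver xs (λ x → indicator (P? x) (F x))
    sumOver-filter P? []       F = refl
    sumOver-filter P? (x ∷ xs) F with P? x
    ... | yes _ = +-congˡ (sumOver-filter P? xs F)
    ... | no _  = trans (sumOver-filter P? xs F) (sym (+-identityˡ _))

  module _ {a b} {A : Set a} {B : Set b} where

    sumOver-map : ∀ xs (φ : A → B) (F : B → Carrier) → sumOver (map φ xs) F ≈ sumOver xs (λ x → F (φ x))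
    sumOver-map []       φ F = refl
    sumOver-map (x ∷ xs) φ F = +-congˡ (sumOver-map xs φ F)

    sumOver-concatMap : ∀ xs (φ : A → List B) (F : B → Carrier) →
                        sumOver (concatMap φ xs) F ≈ sumOver xs (λ x → sumOver (φ x) F)
    sumOver-concatMap []       φ F = refl
    sumOver-concatMap (x ∷ xs) φ F =
      trans (sumOver-++ (φ x) (concatMap φ xs) F) (+-congˡ (sumOver-concatMap xs φ F))

    sumOver-swap : ∀ xs ys (F : A → B → Carrier) →
                   sumOver xs (λ x → sumOver ys (F x)) ≈ sumOver ys (λ y → sumOver xs (λ x → F x y))
    sumOver-swap []       ys F = sym (sumOver-zero ys)
    sumOver-swap (x ∷ xs) ys F = begin
      sumOver ys (F x) + sumOver xs (λ x → sumOver ys (F x))     ≈⟨ +-congˡ (sumOver-swap xs ys F) ⟩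
      sumOver ys (F x) + sumOver ys (λ y → sumOver xs (λ x → F x y)) ≈⟨ sumOver-+ ys (F x) _ ⟨
      sumOver ys (λ y → sumOver (x ∷ xs) (λ x → F x y))         ∎

  prodF-cong : ∀ {n} {F G : Fin n → Carrier} → (∀ i → F i ≈ G i) → prodF F ≈ prodF G
  prodF-cong {zero}  F≈G = refl
  prodF-cong {suc n} F≈G = *-cong (F≈G zero) (prodF-cong (λ i → F≈G (suc i)))

  prodF-* : ∀ {n} (F G : Fin n → Carrier) → prodF (λ i → F i * G i) ≈ prodF F * prodF G
  prodF-* {zero}  F G = sym (*-identityˡ 1#)
  prodF-* {suc n} F G =
    trans (*-congˡ (prodF-* (λ i → F (suc i)) (λ i → G (suc i)))) (*-interchange (F zero) (G zero) _ _)

  prodF-indicator : ∀ {n p} {P : Fin n → Set p} (P? : ∀ i → Dec (P i)) (∀P? : Dec (∀ i → P i))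
                    (x : Fin n → Carrier) →
                    prodF (λ i → indicator (P? i) (x i)) ≈ indicator ∀P? (prodF x)
  prodF-indicator {zero} P? ∀P? x = sym (indicator-yes ∀P? (λ ()) 1#)
  prodF-indicator {suc n} {P = P} P? ∀P? x with P? zero
  ... | yes p₀ = begin
    x zero * prodF (λ i → indicator (P? (suc i)) (x (suc i)))
      ≈⟨ *-congˡ (prodF-indicator (λ i → P? (suc i)) ∀P?ₜ (λ i → x (suc i))) ⟩
    x zero * indicator ∀P?ₜ (prodF (λ i → x (suc i)))
      ≈⟨ *-indicator ∀P?ₜ (x zero) _ ⟩
    indicator ∀P?ₜ (prodF x)
      ≈⟨ indicator-cong ∀P?ₜ ∀P? ∀P (λ ∀p i → ∀p (suc i)) refl ⟩
    indicator ∀P? (prodF x) ∎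
    where
    ∀P?ₜ = all? (λ i → P? (suc i))
    ∀P : (∀ i → P (suc i)) → ∀ i → P i
    ∀P ∀p zero    = p₀
    ∀P ∀p (suc i) = ∀p i
  ... | no ¬p₀ = trans (zeroˡ _) (sym (indicator-no ∀P? (λ ∀p → ¬p₀ (∀p zero)) _))

  prodF-sumOver-divisors : ∀ {n} (k : Fin n → ℕ) (G : Fin n → ℕ → Carrier) →
    prodF (λ i → sumOver (divisors (k i)) (G i)) ≈ sumDiv k (λ d → prodF (λ i → G i (d i)))
  prodF-sumOver-divisors {zero}  k G = sym (+-identityʳ 1#)
  prodF-sumOver-divisors {suc n} k G = begin
    sumOver D₀ (G zero) * prodF (λ i → sumOver (divisors (k (suc i))) (G (suc i)))
      ≈⟨ *-congˡ (prodF-sumOver-divisors (λ i → k (suc i)) (λ i → G (suc i))) ⟩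
    sumOver D₀ (G zero) * sumOver T Πₜ
      ≈⟨ *-distribʳ-sumOver D₀ _ (G zero) ⟩
    sumOver D₀ (λ e → G zero e * sumOver T Πₜ)
      ≈⟨ sumOver-cong D₀ (λ e → *-distribˡ-sumOver T (G zero e) Πₜ) ⟩
    sumOver D₀ (λ e → sumOver T (λ t → G zero e * Πₜ t))
      ≈⟨ sumOver-cong D₀ (λ e → sumOver-map T (e ∷ᶠ_) Π) ⟨
    sumOver D₀ (λ e → sumOver (map (e ∷ᶠ_) T) Π)
      ≈⟨ sumOver-concatMap D₀ (λ e → map (e ∷ᶠ_) T) Π ⟨
    sumDiv k Π ∎
    where
    D₀ = divisors (k zero)
    T = divTuples (λ i → k (suc i))
    Π : (Fin (suc n) → ℕ) → Carrier
    Π d = prodF (λ i → G i (d i))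
    Πₜ : (Fin n → ℕ) → Carrier
    Πₜ t = prodF (λ i → G (suc i) (t i))

  range1-suc : ∀ N → range1 (suc N) ≡ 1 ∷ map suc (range1 N)
  range1-suc N = ≡.cong (λ xs → 1 ∷ map suc xs) (≡.sym (map-upTo suc N))

  sumTo-suc : ∀ N (F : ℕ → Carrier) → sumTo (suc N) F ≈ F 1 + sumTo N (λ j → F (suc j))
  sumTo-suc N F = begin
    sumTo (suc N) F                       ≡⟨ ≡.cong (λ xs → sumOver xs F) (range1-suc N) ⟩
    F 1 + sumOver (map suc (range1 N)) F  ≈⟨ +-congˡ (sumOver-map (range1 N) suc F) ⟩
    F 1 + sumTo N (λ j → F (suc j))       ∎

  sumTo-sucʳ : ∀ N (F : ℕ → Carrier) → sumTo (suc N) F ≈ sumTo N F + F (suc N)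
  sumTo-sucʳ zero    F = +-comm (F 1) 0#
  sumTo-sucʳ (suc N) F = begin
    sumTo (suc (suc N)) F                                    ≈⟨ sumTo-suc (suc N) F ⟩
    F 1 + sumTo (suc N) (λ j → F (suc j))                    ≈⟨ +-congˡ (sumTo-sucʳ N (λ j → F (suc j))) ⟩
    F 1 + (sumTo N (λ j → F (suc j)) + F (suc (suc N)))      ≈⟨ +-assoc _ _ _ ⟨
    (F 1 + sumTo N (λ j → F (suc j))) + F (suc (suc N))      ≈⟨ +-congʳ (sumTo-suc N F) ⟨
    sumTo (suc N) F + F (suc (suc N))                        ∎

  sumTo-cong : ∀ N {F G : ℕ → Carrier} → (∀ j → .{{NonZero j}} → j ≤ N → F j ≈ G j) →
               sumTo N F ≈ sumTo N G
  sumTo-cong zero    F≈G = refl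
  sumTo-cong (suc N) {F} {G} F≈G = begin
    sumTo (suc N) F
      ≈⟨ sumTo-suc N F ⟩
    F 1 + sumTo N (λ j → F (suc j))
      ≈⟨ +-cong (F≈G 1 (s≤s z≤n)) (sumTo-cong N (λ j j≤N → F≈G (suc j) (s≤s j≤N))) ⟩
    G 1 + sumTo N (λ j → G (suc j))
      ≈⟨ sumTo-suc N G ⟨
    sumTo (suc N) G ∎

  sumTo-+ : ∀ m n (F : ℕ → Carrier) → sumTo (m +ℕ n) F ≈ sumTo m F + sumTo n (λ j → F (m +ℕ j))
  sumTo-+ zero    n F = sym (+-identityˡ _)
  sumTo-+ (suc m) n F = begin
    sumTo (suc m +ℕ n) F
      ≈⟨ sumTo-suc (m +ℕ n) F ⟩
    F 1 + sumTo (m +ℕ n) (λ j → F (suc j))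
      ≈⟨ +-congˡ (sumTo-+ m n (λ j → F (suc j))) ⟩
    F 1 + (sumTo m (λ j → F (suc j)) + sumTo n (λ j → F (suc m +ℕ j)))
      ≈⟨ +-assoc _ _ _ ⟨
    (F 1 + sumTo m (λ j → F (suc j))) + sumTo n (λ j → F (suc m +ℕ j))
      ≈⟨ +-congʳ (sumTo-suc m F) ⟨
    sumTo (suc m) F + sumTo n (λ j → F (suc m +ℕ j)) ∎

  sumTo-multiples : ∀ m .{{_ : NonZero m}} L (F : ℕ → Carrier) →
    sumTo (m *ℕ L) (λ j → indicator (m ∣? j) (F j)) ≈ sumTo L (λ l → F (m *ℕ l))
  sumTo-multiples m zero    F =
    reflexive (≡.cong (λ N → sumTo N (λ j → indicator (m ∣? j) (F j))) (ℕₚ.*-zeroʳ m))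
  sumTo-multiples m@(suc m′) (suc L) F = begin
    sumTo (m *ℕ suc L) G
      ≡⟨ ≡.cong (λ N → sumTo N G) (ℕₚ.*-suc m L) ⟩
    sumTo (m +ℕ m *ℕ L) G
      ≈⟨ sumTo-+ m (m *ℕ L) G ⟩
    sumTo m G + sumTo (m *ℕ L) (λ j → G (m +ℕ j))
      ≈⟨ +-cong first-block (sumOver-cong (range1 (m *ℕ L)) shift) ⟩
    F (m *ℕ 1) + sumTo (m *ℕ L) (λ j → indicator (m ∣? j) (F (m +ℕ j)))
      ≈⟨ +-congˡ (sumTo-multiples m L (λ j → F (m +ℕ j))) ⟩
    F (m *ℕ 1) + sumTo L (λ l → F (m +ℕ m *ℕ l))
      ≈⟨ +-congˡ (sumOver-cong (range1 L) (λ l → reflexive (≡.cong F (≡.sym (ℕₚ.*-suc m l))))) ⟩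
    F (m *ℕ 1) + sumTo L (λ l → F (m *ℕ suc l))
      ≈⟨ sumTo-suc L (λ l → F (m *ℕ l)) ⟨
    sumTo (suc L) (λ l → F (m *ℕ l)) ∎
    where
    G : ℕ → Carrier
    G j = indicator (m ∣? j) (F j)
    m∤ : ∀ j → .{{NonZero j}} → j ≤ m′ → ¬ m ∣ j
    m∤ j j≤m′ m∣j = ℕₚ.<-irrefl ≡.refl (ℕₚ.≤-trans (∣⇒≤ m∣j) j≤m′)
    first-block : sumTo m G ≈ F (m *ℕ 1)
    first-block = begin
      sumTo m G          ≈⟨ sumTo-sucʳ m′ G ⟩
      sumTo m′ G + G m   ≈⟨ +-cong (sumTo-cong m′ (λ j j≤m′ → indicator-no (m ∣? j) (m∤ j j≤m′) (F j)))
                                   (indicator-yes (m ∣? m) ∣-refl (F m)) ⟩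
      sumTo m′ (λ _ → 0#) + F m  ≈⟨ +-congʳ (sumOver-zero (range1 m′)) ⟩
      0# + F m           ≈⟨ +-identityˡ (F m) ⟩
      F m                ≡⟨ ≡.cong F (ℕₚ.*-identityʳ m) ⟨
      F (m *ℕ 1)         ∎
    shift : ∀ j → G (m +ℕ j) ≈ indicator (m ∣? j) (F (m +ℕ j))
    shift j = indicator-cong (m ∣? m +ℕ j) (m ∣? j)
      (λ m∣m+j → ∣m+n∣m⇒∣n m∣m+j ∣-refl) (∣m∣n⇒∣m+n ∣-refl) refl

module CompletelyMultiplicativeFunctions {c ℓ : Level} (R : CommutativeRing c ℓ) where

  open CommutativeRing R
  open RingDefs R
  open import Data.Nat using (suc)
  open import Data.Nat.Properties using (m^n≢0)
  open import Data.Product using (proj₁; proj₂)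

  module _ {F : ArithFun} (F-cm : CompletelyMultiplicative F) where

    cm-* : ∀ x y → .{{NonZero x}} → .{{NonZero y}} → F (x *ℕ y) ≈ F x * F y
    cm-* (suc x) (suc y) = proj₂ F-cm x y

    cm-^ : ∀ x a → .{{NonZero x}} → F (x ^ℕ a) ≈ pow (F x) a
    cm-^ x 0       = proj₁ F-cm
    cm-^ x (suc a) {{x≢0}} = trans (cm-* x (x ^ℕ a) {{x≢0}} {{m^n≢0 x a}}) (*-congˡ (cm-^ x a))

    cm-^-* : ∀ x a y → .{{NonZero x}} → .{{NonZero y}} → F (x ^ℕ a *ℕ y) ≈ pow (F x) a * F y
    cm-^-* x a y = trans (cm-* (x ^ℕ a) y {{m^n≢0 x a}}) (*-congʳ (cm-^ x a))

module AndersonApostol {c ℓ : Level} (R : CommutativeRing c ℓ) where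

  open CommutativeRing R
  open RingDefs R
  open Sums R
  open CompletelyMultiplicativeFunctions R
  open import Data.Nat.Properties using (m^n≢0) renaming (*-comm to *ℕ-comm)
  open import Data.Nat.Divisibility using (_∣_; _∣?_; ∣-trans)
  open import Data.Fin.Properties using (all?)
  open import Data.Product using (proj₁; proj₂)
  open import Relation.Binary.PropositionalEquality as ≡ using (_≡_)
  open import Relation.Binary.Reasoning.Setoid setoid
  open import Algebra.Properties.CommutativeSemigroup *-commutativeSemigroup
    using (x∙yz≈y∙xz) renaming (interchange to *-interchange)

  module _ (a : ℕ) {n : ℕ} (k : Fin n → ℕ) (f g h : Fin n → ArithFun) (ω : ArithFun)
           (ω-cm : CompletelyMultiplicative ω) where

    K : ℕ
    K = lcmF k

    coefficient : (Fin n → ℕ) → Carrier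
    coefficient d = prodF (λ i → f i (d i) * g i (quot (k i) (d i)))

    summand : Fin n → ℕ → ℕ → Carrier
    summand i e j = f i e * g i (quot (k i) e) * h i (quot j (e ^ℕ a))

    restricted : (Fin n → ℕ) → ℕ → Carrier
    restricted d j = prodF (λ i → indicator (d i ^ℕ a ∣? j) (summand i (d i) j))

    U≈sumDiv-sumTo : U a ω f g h k ≈ sumDiv k (λ d → sumTo (K ^ℕ a) (λ j → ω j * restricted d j))
    U≈sumDiv-sumTo = begin
      U a ω f g h k
        ≈⟨ sumOver-cong (range1 (K ^ℕ a)) expand ⟩
      sumTo (K ^ℕ a) (λ j → sumDiv k (λ d → ω j * restricted d j))
        ≈⟨ sumOver-swap (range1 (K ^ℕ a)) (divTuples k) (λ j d → ω j * restricted d j) ⟩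
      sumDiv k (λ d → sumTo (K ^ℕ a) (λ j → ω j * restricted d j)) ∎
      where
      expand : ∀ j → ω j * prodF (λ i → sAA a (f i) (g i) (h i) (k i) j)
                     ≈ sumDiv k (λ d → ω j * restricted d j)
      expand j = begin
        ω j * prodF (λ i → sAA a (f i) (g i) (h i) (k i) j)
          ≈⟨ *-congˡ (prodF-cong (λ i →
               sumOver-filter (λ e → e ^ℕ a ∣? j) (divisors (k i)) (λ e → summand i e j))) ⟩
        ω j * prodF (λ i → sumOver (divisors (k i)) (λ e → indicator (e ^ℕ a ∣? j) (summand i e j)))
          ≈⟨ *-congˡ (prodF-sumOver-divisors k (λ i e → indicator (e ^ℕ a ∣? j) (summand i e j))) ⟩
        ω j * sumDiv k (λ d → restricted d j)
          ≈⟨ *-distribˡ-sumOver (divTuples k) (ω j) (λ d → restricted d j) ⟩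
        sumDiv k (λ d → ω j * restricted d j) ∎

    module _ (d : Fin n → ℕ) (d-valid : IsDivisorTuple k d) where

      private
        M = lcmF d
        L = quot K M
        instance
          d≢0 : ∀ {i} → NonZero (d i)
          d≢0 {i} = proj₁ (d-valid i)
          M≢0 : NonZero M
          M≢0 = lcmF-nonZero d (λ i → d≢0)
          M^a≢0 : NonZero (M ^ℕ a)
          M^a≢0 = m^n≢0 M a

      M∣K : M ∣ K
      M∣K = lcmF-least d (λ i → ∣-trans (proj₂ (d-valid i)) (lcmF-∣ k i))

      K^a≡M^a*L^a : K ^ℕ a ≡ M ^ℕ a *ℕ L ^ℕ a
      K^a≡M^a*L^a = ≡.trans (≡.cong (_^ℕ a) (≡.sym (quot[m,n]*n≡m M M∣K)))
                      (≡.trans (^-distrib-* L M a) (*ℕ-comm (L ^ℕ a) (M ^ℕ a)))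

      H : ℕ → Carrier
      H j = prodF (λ i → h i (quot j (d i ^ℕ a)))

      H′ : ℕ → Carrier
      H′ l = prodF (λ i → h i (quot M (d i) ^ℕ a *ℕ l))

      collapse : ∀ j → ω j * restricted d j ≈ indicator (M ^ℕ a ∣? j) (ω j * (coefficient d * H j))
      collapse j = begin
        ω j * restricted d j
          ≈⟨ *-congˡ (prodF-indicator (λ i → d i ^ℕ a ∣? j) all-d^a∣? (λ i → summand i (d i) j)) ⟩
        ω j * indicator all-d^a∣? (prodF (λ i → summand i (d i) j))
          ≈⟨ *-indicator all-d^a∣? (ω j) _ ⟩
        indicator all-d^a∣? (ω j * prodF (λ i → summand i (d i) j))
          ≈⟨ indicator-cong all-d^a∣? (M ^ℕ a ∣? j) (lcmF-^-least d a)
               (λ M^a∣j i → ∣-trans (^-monoˡ-∣ a (lcmF-∣ d i)) M^a∣j)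
               (*-congˡ (prodF-* (λ i → f i (d i) * g i (quot (k i) (d i)))
                                 (λ i → h i (quot j (d i ^ℕ a))))) ⟩
        indicator (M ^ℕ a ∣? j) (ω j * (coefficient d * H j)) ∎
        where all-d^a∣? = all? (λ i → d i ^ℕ a ∣? j)

      at-multiple : ∀ l → .{{NonZero l}} →
                    ω (M ^ℕ a *ℕ l) * (coefficient d * H (M ^ℕ a *ℕ l))
                      ≈ (pow (ω M) a * coefficient d) * (ω l * H′ l)
      at-multiple l = begin
        ω (M ^ℕ a *ℕ l) * (coefficient d * H (M ^ℕ a *ℕ l))
          ≈⟨ *-cong (cm-^-* ω-cm M a l)
                    (*-congˡ (prodF-cong (λ i →
                       reflexive (≡.cong (h i) (quot-^-* (d i) a l (lcmF-∣ d i)))))) ⟩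
        (pow (ω M) a * ω l) * (coefficient d * H′ l)
          ≈⟨ *-interchange _ _ _ _ ⟩
        (pow (ω M) a * coefficient d) * (ω l * H′ l) ∎

      contribution : sumTo (K ^ℕ a) (λ j → ω j * restricted d j)
                     ≈ pow (ω M) a * coefficient d * sumTo (L ^ℕ a) (λ l → ω l * H′ l)
      contribution = begin
        sumTo (K ^ℕ a) (λ j → ω j * restricted d j)
          ≈⟨ sumOver-cong (range1 (K ^ℕ a)) collapse ⟩
        sumTo (K ^ℕ a) (λ j → indicator (M ^ℕ a ∣? j) (Φ j))
          ≡⟨ ≡.cong (λ N → sumTo N (λ j → indicator (M ^ℕ a ∣? j) (Φ j))) K^a≡M^a*L^a ⟩
        sumTo (M ^ℕ a *ℕ L ^ℕ a) (λ j → indicator (M ^ℕ a ∣? j) (Φ j))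
          ≈⟨ sumTo-multiples (M ^ℕ a) (L ^ℕ a) Φ ⟩
        sumTo (L ^ℕ a) (λ l → Φ (M ^ℕ a *ℕ l))
          ≈⟨ sumTo-cong (L ^ℕ a) (λ l _ → at-multiple l) ⟩
        sumTo (L ^ℕ a) (λ l → (pow (ω M) a * coefficient d) * (ω l * H′ l))
          ≈⟨ *-distribˡ-sumOver (range1 (L ^ℕ a)) _ _ ⟨
        pow (ω M) a * coefficient d * sumTo (L ^ℕ a) (λ l → ω l * H′ l) ∎
        where
        Φ : ℕ → Carrier
        Φ j = ω j * (coefficient d * H j)

      factor-h : (∀ i → CompletelyMultiplicative (h i)) →
                 pow (ω M) a * coefficient d * sumTo (L ^ℕ a) (λ l → ω l * H′ l)
                 ≈ pow (ω M) a * prodF (λ i → f i (d i) * g i (quot (k i) (d i)) * pow (h i (quot M (d i))) a)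
                   * sumTo (L ^ℕ a) (λ l → ω l * prodF (λ i → h i l))
      factor-h h-cm = begin
        ω^a * coefficient d * sumTo (L ^ℕ a) (λ l → ω l * H′ l)
          ≈⟨ *-congˡ (sumTo-cong (L ^ℕ a) (λ l _ → split l)) ⟩
        ω^a * coefficient d * sumTo (L ^ℕ a) (λ l → hᵃ * (ω l * Hₗ l))
          ≈⟨ *-congˡ (*-distribˡ-sumOver (range1 (L ^ℕ a)) hᵃ _) ⟨
        ω^a * coefficient d * (hᵃ * sumTo (L ^ℕ a) (λ l → ω l * Hₗ l))
          ≈⟨ *-assoc _ _ _ ⟨
        ω^a * coefficient d * hᵃ * sumTo (L ^ℕ a) (λ l → ω l * Hₗ l)
          ≈⟨ *-congʳ (*-assoc _ _ _) ⟩
        ω^a * (coefficient d * hᵃ) * sumTo (L ^ℕ a) (λ l → ω l * Hₗ l)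
          ≈⟨ *-congʳ (*-congˡ (prodF-* (λ i → f i (d i) * g i (quot (k i) (d i))) hᵢᵃ)) ⟨
        ω^a * prodF (λ i → f i (d i) * g i (quot (k i) (d i)) * pow (h i (quot M (d i))) a)
          * sumTo (L ^ℕ a) (λ l → ω l * Hₗ l) ∎
        where
        ω^a = pow (ω M) a
        hᵢᵃ : Fin n → Carrier
        hᵢᵃ i = pow (h i (quot M (d i))) a
        hᵃ = prodF hᵢᵃ
        Hₗ : ℕ → Carrier
        Hₗ l = prodF (λ i → h i l)
        split : ∀ l → .{{NonZero l}} → ω l * H′ l ≈ hᵃ * (ω l * Hₗ l)
        split l = trans (*-congˡ (trans (prodF-cong λ i → cm-^-* {h i} (h-cm i) (quot M (d i)) a l
                                                             {{quot-nonZero (d i) (lcmF-∣ d i)}})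
                                        (prodF-* hᵢᵃ (λ i → h i l))))
                        (x∙yz≈y∙xz _ _ _)

    first-form : U a ω f g h k ≈
      sumDiv k (λ d → pow (ω (lcmF d)) a * coefficient d
                        * sumTo (quot K (lcmF d) ^ℕ a) (λ l →
                            ω l * prodF (λ i → h i (quot (lcmF d) (d i) ^ℕ a *ℕ l))))
    first-form = trans U≈sumDiv-sumTo (sumOver-congᴬ (divTuples-valid k) contribution)

    second-form : (∀ i → CompletelyMultiplicative (h i)) → U a ω f g h k ≈
      sumDiv k (λ d → pow (ω (lcmF d)) a
                        * prodF (λ i → f i (d i) * g i (quot (k i) (d i)) * pow (h i (quot (lcmF d) (d i))) a)
                        * sumTo (quot K (lcmF d) ^ℕ a) (λ l → ω l * prodF (λ i → h i l)))
    second-form h-cm =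
      trans first-form (sumOver-congᴬ (divTuples-valid k) (λ d d-valid → factor-h d d-valid h-cm))

theorem1 : ∀ {c ℓ : Level} (R : CommutativeRing c ℓ) →
  let open CommutativeRing R
      open RingDefs R
  in (a n : ℕ) → NonZero a → NonZero n →
     (k : Fin n → ℕ) → (∀ i → NonZero (k i)) →
     (f g h : Fin n → ArithFun) (ω : ArithFun) → CompletelyMultiplicative ω →
     (U a ω f g h k ≈
        sumDiv k (λ d →
          pow (ω (lcmF d)) a
          * prodF (λ i → f i (d i) * g i (quot (k i) (d i)))
          * sumTo (quot (lcmF k) (lcmF d) ^ℕ a) (λ l →
              ω l * prodF (λ i → h i ((quot (lcmF d) (d i) ^ℕ a) *ℕ l)))))
     ×
     ((∀ i → CompletelyMultiplicative (h i)) →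
      U a ω f g h k ≈
        sumDiv k (λ d →
          pow (ω (lcmF d)) a
          * prodF (λ i → f i (d i) * g i (quot (k i) (d i))
                         * pow (h i (quot (lcmF d) (d i))) a)
          * sumTo (quot (lcmF k) (lcmF d) ^ℕ a) (λ l →
              ω l * prodF (λ i → h i l))))
theorem1 R a _ _ _ k _ f g h ω ω-cm = first-form a k f g h ω ω-cm , second-form a k f g h ω ω-cm
  where open AndersonApostol R
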